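{- Let $n\ge4$ be even. For $1\le i\le n-1$, $Y_i=\{z\in\mathcal F_n: z(1)=i+1\}$. Consequently $\mathcal F_n=Y_1\sqcup Y_2\sqcup\cdots\sqcup Y_{n-1}$.
   Context: $S_n$ is the symmetric group on $\{1,\dots,n\}$, $s_i=(i,i+1)$, and $\mathcal F_m$ is the set of fixed-point-free involutions in $S_m$. View $S_{n-2}\subset S_n$ as the permutations fixing $n-1$ and $n$, so $\mathcal F_{n-2}\subset S_n$. Let $w_0$ be the longest element of $S_n$ ($i\mapsto n+1-i$) and $\rho_n:\mathcal F_{n-2}\to\mathcal F_n$, $\rho_n(z)=w_0zs_{n-1}w_0$. Put $\sigma_i=s_is_{i-1}\cdots s_1$, $Y_1=\rho_n(\mathcal F_{n-2})$ and $Y_i=\sigma_iY_1\sigma_i^{ -1}$ for $1\le i\le n-1$. -}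

module Defs where

open import Data.Nat using (ℕ; zero; suc; _+_; _∸_; _≤_; _<?_; _≡ᵇ_)
open import Data.Fin using (Fin; toℕ; fromℕ<)
open import Data.Bool using (if_then_else_)
open import Data.Product using (Σ; _×_)
open import Relation.Nullary using (¬_; yes; no)
open import Relation.Binary.PropositionalEquality using (_≡_)
open import Function using (_∘_; id)

-- Points of {1,…,n} are represented by Fin n; the point with label k
-- (1 ≤ k ≤ n) is the element of Fin n with toℕ = k - 1.
lab : {n : ℕ} → Fin n → ℕ
lab x = suc (toℕ x)

-- Elements of S_n are maps Fin n → Fin n, composed as functions
-- (the product zw means z ∘ w, i.e. w is applied first).
Perm : ℕ → Set
Perm n = Fin n → Fin n

-- Turn a map on labels {1,…,n} (given as ℕ → ℕ) into a map on Fin n.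
-- (The fallback branch is never reached for the maps used below.)
liftLab : {n : ℕ} → (ℕ → ℕ) → Perm n
liftLab {n} f x with f (lab x) ∸ 1 <? n
... | yes p = fromℕ< p
... | no _  = x

sℕ : ℕ → ℕ → ℕ
sℕ i k = if k ≡ᵇ i then suc i else (if k ≡ᵇ suc i then i else k)

s : {n : ℕ} → ℕ → Perm n
s i = liftLab (sℕ i)

w₀ : {n : ℕ} → Perm n
w₀ {n} = liftLab (λ k → suc n ∸ k)

σ : {n : ℕ} → ℕ → Perm n
σ zero    = id
σ (suc i) = s (suc i) ∘ σ i

σ⁻¹ : {n : ℕ} → ℕ → Perm n
σ⁻¹ zero    = id
σ⁻¹ (suc i) = σ⁻¹ i ∘ s (suc i)

-- 𝓕_n : fixed-point-free involutions in S_n.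
-- (An involution of Fin n is automatically a bijection, i.e. in S_n.)
IsFPFInv : {n : ℕ} → Perm n → Set
IsFPFInv z = (∀ x → z (z x) ≡ x) × (∀ x → ¬ (z x ≡ x))

-- 𝓕_{n-2} ⊂ S_n : permutations fixing n-1 and n that restrict to a
-- fixed-point-free involution of {1,…,n-2}.
IsFPFInvSub : (n : ℕ) → Perm n → Set
IsFPFInvSub n z =
  (∀ x → z (z x) ≡ x) ×
  (∀ x → (lab x ≡ n ∸ 1) → z x ≡ x) ×
  (∀ x → (lab x ≡ n) → z x ≡ x) ×
  (∀ x → lab x ≤ n ∸ 2 → ¬ (z x ≡ x))

ρ : (n : ℕ) → Perm n → Perm n
ρ n z = w₀ ∘ z ∘ s (n ∸ 1) ∘ w₀

Y₁ : (n : ℕ) → Perm n → Set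
Y₁ n z = Σ (Perm n) λ y → IsFPFInvSub n y × (∀ x → z x ≡ ρ n y x)

Y : (n : ℕ) → ℕ → Perm n → Set
Y n i z = Σ (Perm n) λ y → Y₁ n y × (∀ x → z x ≡ σ i (y (σ⁻¹ i x)))

{-# OPTIONS --safe #-}
-- Put t = s_{n-1} = (n-1 n). An involution fixing exactly n-1 and n, and a
-- fixed-point-free involution exchanging n-1 and n, both commute with t; hence
-- y ↦ y t is a bijection from 𝓕_{n-2} onto the fixed-point-free involutions
-- exchanging n-1 and n. Conjugating by w₀ (which exchanges 1 ↔ n and 2 ↔ n-1)
-- turns this into Y₁ = {z ∈ 𝓕_n : z(1) = 2}. Conjugation by σ_i preserves 𝓕_n,
-- and σ_i(1) = i+1, σ_i⁻¹(1) = 2, so it carries Y₁ onto {z ∈ 𝓕_n : z(1) = i+1};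
-- these sets partition 𝓕_n according to the value z(1) ≠ 1.
module Submission where

open import Algebra.Definitions using (Involutive)
open import Data.Bool.Base using (true; false)
open import Data.Bool.Properties using (T-≡)
open import Data.Fin.Base using (Fin; zero; suc; toℕ; fromℕ; fromℕ<)
open import Data.Fin.Properties using (toℕ-injective; toℕ<n; toℕ≤pred[n]; toℕ-fromℕ; toℕ-fromℕ<; pred<; _≟_)
open import Data.Nat.Base using (ℕ; suc; _≤_; _<_; _∸_; _≡ᵇ_; z≤n; s≤s)
open import Data.Nat.Divisibility using (_∣_)
open import Data.Nat.Properties as ℕ
  using (_<?_; ≡ᵇ⇒≡; ≡⇒≡ᵇ; ≤-refl; ≤-trans; <⇒≤; n≤1+n; 1+n≢n; 1+n≰n; ≤∧≢⇒<; m<1+n⇒m≤n;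
         m+[n∸m]≡n; m+n∸n≡m; m∸n≤m; m<n⇒0<n∸m; +-∸-assoc; m∸[m∸n]≡n)
open import Data.Product using (Σ; _×_; _,_; proj₁; proj₂; map₁; map₂)
open import Function.Base using (_∘_; id)
open import Function.Bundles using (Equivalence)
open import Function.Definitions using (Injective)
open import Relation.Nullary using (yes; no; contradiction)
open import Relation.Binary.PropositionalEquality
open import Defs

lab-injective : ∀ {n} {x y : Fin n} → lab x ≡ lab y → x ≡ y
lab-injective e = toℕ-injective (ℕ.suc-injective e)

≢⇒lab≢ : ∀ {n} {x y : Fin n} {k} → x ≢ y → lab y ≡ k → lab x ≢ k
≢⇒lab≢ x≢y y-k e = x≢y (lab-injective (trans e (sym y-k)))

-- Guarantees that liftLab f never takes its fallback branch.
IsLabelInvolution : ℕ → (ℕ → ℕ) → Set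
IsLabelInvolution n f = ∀ {k} → 1 ≤ k → k ≤ n → 1 ≤ f k × f k ≤ n × f (f k) ≡ k

module _ {n : ℕ} {f : ℕ → ℕ} (inv : IsLabelInvolution n f) where

  lab-liftLab : (x : Fin n) → lab (liftLab f x) ≡ f (lab x)
  lab-liftLab x with f (lab x) ∸ 1 <? n | inv (s≤s z≤n) (toℕ<n x)
  ... | yes p  | 1≤fx , _ , _    = trans (cong suc (toℕ-fromℕ< p)) (m+[n∸m]≡n 1≤fx)
  ... | no ¬p  | 1≤fx , fx≤n , _ = contradiction (subst (_≤ n) (sym (m+[n∸m]≡n 1≤fx)) fx≤n) ¬p

  liftLab-involutive : Involutive _≡_ (liftLab {n} f)
  liftLab-involutive x = lab-injective (begin
    lab (liftLab f (liftLab f x)) ≡⟨ lab-liftLab (liftLab f x) ⟩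
    f (lab (liftLab f x))         ≡⟨ cong f (lab-liftLab x) ⟩
    f (f (lab x))                 ≡⟨ proj₂ (proj₂ (inv (s≤s z≤n) (toℕ<n x))) ⟩
    lab x                         ∎)
    where open ≡-Reasoning

≡ᵇ-refl : ∀ k → (k ≡ᵇ k) ≡ true
≡ᵇ-refl k = Equivalence.to T-≡ (≡⇒≡ᵇ k k refl)

≡ᵇ-true⇒≡ : ∀ {j k} → (j ≡ᵇ k) ≡ true → j ≡ k
≡ᵇ-true⇒≡ {j} {k} e = ≡ᵇ⇒≡ j k (Equivalence.from T-≡ e)

sℕ-left : ∀ j → sℕ j j ≡ suc j
sℕ-left j rewrite ≡ᵇ-refl j = refl

sℕ-right : ∀ j → sℕ j (suc j) ≡ j
sℕ-right j with suc j ≡ᵇ j in e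
... | true  = contradiction (≡ᵇ-true⇒≡ {suc j} e) 1+n≢n
... | false rewrite ≡ᵇ-refl j = refl

sℕ-other : ∀ {j k} → k ≢ j → k ≢ suc j → sℕ j k ≡ k
sℕ-other {j} {k} k≢j k≢1+j with k ≡ᵇ j in e₁
... | true  = contradiction (≡ᵇ-true⇒≡ {k} e₁) k≢j
... | false with k ≡ᵇ suc j in e₂
...   | true  = contradiction (≡ᵇ-true⇒≡ {k} e₂) k≢1+j
...   | false = refl

sℕ-isLabelInvolution : ∀ {j n} → 1 ≤ j → j < n → IsLabelInvolution n (sℕ j)
sℕ-isLabelInvolution {j} {n} 1≤j j<n {k} 1≤k k≤n with k ℕ.≟ j | k ℕ.≟ suc j
... | yes refl | _ rewrite sℕ-left k = s≤s z≤n , j<n , sℕ-right k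
... | no _ | yes refl rewrite sℕ-right j = 1≤j , ≤-trans (n≤1+n j) k≤n , sℕ-left j
... | no k≢j | no k≢1+j rewrite sℕ-other k≢j k≢1+j = 1≤k , k≤n , sℕ-other k≢j k≢1+j

w₀-isLabelInvolution : ∀ n → IsLabelInvolution n (suc n ∸_)
w₀-isLabelInvolution n {suc k} _ k<n =
  m<n⇒0<n∸m k<n , m∸n≤m n k ,
  trans (+-∸-assoc 1 (m∸n≤m n k)) (cong suc (m∸[m∸n]≡n (<⇒≤ k<n)))

Sends : ∀ {n} → Perm n → ℕ → ℕ → Set
Sends f a b = ∀ x → lab x ≡ a → lab (f x) ≡ b

module _ {n : ℕ} where

  involutive⇒injective : ∀ {f : Perm n} → Involutive _≡_ f → Injective _≡_ _≡_ f
  involutive⇒injective {f} inv {x} {y} e = trans (sym (inv x)) (trans (cong f e) (inv y))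

  involution-swap : ∀ {f : Perm n} {x y} → Involutive _≡_ f → f x ≡ y → f y ≡ x
  involution-swap {f} {x} inv fx≡y = trans (cong f (sym fx≡y)) (inv x)

  commuting-involutions : ∀ {f g : Perm n} → Involutive _≡_ f → Involutive _≡_ g →
                          f ∘ g ≗ g ∘ f → Involutive _≡_ (f ∘ g)
  commuting-involutions {f} {g} f-inv g-inv fg≗gf x = begin
    f (g (f (g x))) ≡⟨ fg≗gf (f (g x)) ⟩
    g (f (f (g x))) ≡⟨ cong g (f-inv (g x)) ⟩
    g (g x)         ≡⟨ g-inv x ⟩
    x               ∎
    where open ≡-Reasoning

  IsFPFInv-resp : ∀ {f g : Perm n} → f ≗ g → IsFPFInv g → IsFPFInv f
  IsFPFInv-resp {f} {g} f≗g (inv , free) =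
    (λ x → trans (f≗g (f x)) (trans (cong g (f≗g x)) (inv x))) ,
    (λ x e → free x (trans (sym (f≗g x)) e))

  IsFPFInv-conj : ∀ {g h z : Perm n} → g ∘ h ≗ id → h ∘ g ≗ id →
                  IsFPFInv z → IsFPFInv (g ∘ z ∘ h)
  IsFPFInv-conj {g} {h} {z} gh hg (inv , free) =
    (λ x → trans (cong (g ∘ z) (hg (z (h x)))) (trans (cong g (inv (h x))) (gh x))) ,
    (λ x e → free (h x) (trans (sym (hg (z (h x)))) (cong h e)))

  Sends-∘ : ∀ {f g : Perm n} {a b c} → Sends g b c → Sends f a b → Sends (g ∘ f) a c
  Sends-∘ {f} g-bc f-ab x e = g-bc (f x) (f-ab x e)

  Sends-resp : ∀ {f g : Perm n} {a b} → f ≗ g → Sends g a b → Sends f a b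
  Sends-resp f≗g g-ab x e = trans (cong lab (f≗g x)) (g-ab x e)

  Sends⇒≡ : ∀ {f : Perm n} {a b x y} → Sends f a b → lab x ≡ a → lab y ≡ b → f x ≡ y
  Sends⇒≡ {x = x} f-ab x-a y-b = lab-injective (trans (f-ab x x-a) (sym y-b))

  ≡⇒Sends : ∀ {f : Perm n} {a b x y} → f x ≡ y → lab x ≡ a → lab y ≡ b → Sends f a b
  ≡⇒Sends {f} fx≡y x-a y-b x′ e =
    trans (cong (lab ∘ f) (lab-injective (trans e (sym x-a)))) (trans (cong lab fx≡y) y-b)

  Sends-swap : ∀ {f : Perm n} {x b} → Involutive _≡_ f → Sends f (lab x) b → Sends f b (lab x)
  Sends-swap inv f-xb y e = cong lab (involution-swap inv (Sends⇒≡ f-xb refl e))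

  s-lab : ∀ {j} → 1 ≤ j → j < n → (x : Fin n) → lab (s j x) ≡ sℕ j (lab x)
  s-lab 1≤j j<n = lab-liftLab (sℕ-isLabelInvolution 1≤j j<n)

  s-involutive : ∀ {j} → 1 ≤ j → j < n → Involutive _≡_ (s {n} j)
  s-involutive 1≤j j<n = liftLab-involutive (sℕ-isLabelInvolution 1≤j j<n)

  s-sends : ∀ {j k} → 1 ≤ j → j < n → Sends (s {n} j) k (sℕ j k)
  s-sends 1≤j j<n x e = trans (s-lab 1≤j j<n x) (cong (sℕ _) e)

  s-sends-left : ∀ {j} → 1 ≤ j → j < n → Sends (s {n} j) j (suc j)
  s-sends-left {j} 1≤j j<n = subst (Sends (s j) j) (sℕ-left j) (s-sends 1≤j j<n)

  s-sends-right : ∀ {j} → 1 ≤ j → j < n → Sends (s {n} j) (suc j) j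
  s-sends-right {j} 1≤j j<n = subst (Sends (s j) (suc j)) (sℕ-right j) (s-sends 1≤j j<n)

  s-sends-other : ∀ {j k} → 1 ≤ j → j < n → k ≢ j → k ≢ suc j → Sends (s {n} j) k k
  s-sends-other {j} {k} 1≤j j<n k≢j k≢1+j =
    subst (Sends (s j) k) (sℕ-other k≢j k≢1+j) (s-sends 1≤j j<n)

  σ-σ⁻¹ : ∀ i → i < n → σ {n} i ∘ σ⁻¹ i ≗ id
  σ-σ⁻¹ 0       _     x = refl
  σ-σ⁻¹ (suc i) 1+i<n x =
    trans (cong (s (suc i)) (σ-σ⁻¹ i (≤-trans (n≤1+n _) 1+i<n) (s (suc i) x))) (s-involutive (s≤s z≤n) 1+i<n x)

  σ⁻¹-σ : ∀ i → i < n → σ⁻¹ {n} i ∘ σ i ≗ id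
  σ⁻¹-σ 0       _     x = refl
  σ⁻¹-σ (suc i) 1+i<n x =
    trans (cong (σ⁻¹ i) (s-involutive (s≤s z≤n) 1+i<n (σ i x))) (σ⁻¹-σ i (≤-trans (n≤1+n _) 1+i<n) x)

  σ-sends-1 : ∀ i → i < n → Sends (σ {n} i) 1 (suc i)
  σ-sends-1 0       _     x e = e
  σ-sends-1 (suc i) 1+i<n =
    Sends-∘ {f = σ i} {g = s (suc i)} (s-sends-left (s≤s z≤n) 1+i<n) (σ-sends-1 i (≤-trans (n≤1+n _) 1+i<n))

  -- For i ≥ 2 the first factor s_i of σ_i⁻¹ = s_1 ⋯ s_i fixes 1.
  σ⁻¹-sends-1 : ∀ i → 1 ≤ i → i < n → Sends (σ⁻¹ {n} i) 1 2
  σ⁻¹-sends-1 1             _ 1<n = s-sends-left ≤-refl 1<n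
  σ⁻¹-sends-1 (suc (suc i)) _ i<n =
    Sends-∘ {f = s (suc (suc i))} {g = σ⁻¹ (suc i)}
      (σ⁻¹-sends-1 (suc i) (s≤s z≤n) (≤-trans (n≤1+n _) i<n)) (s-sends-other (s≤s z≤n) i<n (λ ()) (λ ()))

  w₀-involutive : Involutive _≡_ (w₀ {n})
  w₀-involutive = liftLab-involutive (w₀-isLabelInvolution n)

  w₀-lab : (x : Fin n) → lab (w₀ x) ≡ suc n ∸ lab x
  w₀-lab = lab-liftLab (w₀-isLabelInvolution n)

record IsTransposition {n : ℕ} (t : Perm n) (a b : Fin n) : Set where
  field
    distinct : a ≢ b
    sends-a  : t a ≡ b
    sends-b  : t b ≡ a
    fixes    : ∀ x → x ≢ a → x ≢ b → t x ≡ x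

-- 𝓕_{n-2} with n-1, n replaced by arbitrary points a, b: involutions fixing exactly a and b.
IsFPFInvOff : ∀ {n} → Fin n → Fin n → Perm n → Set
IsFPFInvOff a b y = Involutive _≡_ y × y a ≡ a × y b ≡ b × (∀ x → x ≢ a → x ≢ b → y x ≢ x)

module Transposition {n : ℕ} {t : Perm n} {a b : Fin n} (τ : IsTransposition t a b) where
  open IsTransposition τ

  transposition-involutive : Involutive _≡_ t
  transposition-involutive x with x ≟ a | x ≟ b
  ... | yes refl | _        = trans (cong t sends-a) sends-b
  ... | no _     | yes refl = trans (cong t sends-b) sends-a
  ... | no x≢a   | no x≢b   = trans (cong t (fixes x x≢a x≢b)) (fixes x x≢a x≢b)

  fixing-commutes : ∀ {y} → Involutive _≡_ y → y a ≡ a → y b ≡ b → y ∘ t ≗ t ∘ y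
  fixing-commutes {y} inv ya yb x with x ≟ a | x ≟ b
  ... | yes refl | _        = trans (cong y sends-a) (trans yb (trans (sym sends-a) (cong t (sym ya))))
  ... | no _     | yes refl = trans (cong y sends-b) (trans ya (trans (sym sends-b) (cong t (sym yb))))
  ... | no x≢a   | no x≢b   = trans (cong y (fixes x x≢a x≢b)) (sym (fixes (y x) yx≢a yx≢b))
    where
    yx≢a : y x ≢ a
    yx≢a e = x≢a (involutive⇒injective inv (trans e (sym ya)))
    yx≢b : y x ≢ b
    yx≢b e = x≢b (involutive⇒injective inv (trans e (sym yb)))

  swapping-commutes : ∀ {u} → Involutive _≡_ u → u b ≡ a → u ∘ t ≗ t ∘ u
  swapping-commutes {u} inv ub = commutes
    where
    ua : u a ≡ b
    ua = involution-swap inv ub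
    commutes : u ∘ t ≗ t ∘ u
    commutes x with x ≟ a | x ≟ b
    ... | yes refl | _        = trans (cong u sends-a) (trans ub (trans (sym sends-b) (cong t (sym ua))))
    ... | no _     | yes refl = trans (cong u sends-b) (trans ua (trans (sym sends-a) (cong t (sym ub))))
    ... | no x≢a   | no x≢b   = trans (cong u (fixes x x≢a x≢b)) (sym (fixes (u x) ux≢a ux≢b))
      where
      ux≢a : u x ≢ a
      ux≢a e = x≢b (involutive⇒injective inv (trans e (sym ub)))
      ux≢b : u x ≢ b
      ux≢b e = x≢a (involutive⇒injective inv (trans e (sym ua)))

  off⇒∘t : ∀ {y} → IsFPFInvOff a b y → IsFPFInv (y ∘ t) × y (t b) ≡ a
  off⇒∘t {y} (inv , ya , yb , free) =
    (commuting-involutions {f = y} inv transposition-involutive (fixing-commutes inv ya yb) , fixed-point-free) ,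
    yt-b
    where
    yt-b : y (t b) ≡ a
    yt-b = trans (cong y sends-b) ya
    fixed-point-free : ∀ x → y (t x) ≢ x
    fixed-point-free x with x ≟ a | x ≟ b
    ... | yes refl | _        = λ e → distinct (trans (sym e) (trans (cong y sends-a) yb))
    ... | no _     | yes refl = λ e → distinct (trans (sym yt-b) e)
    ... | no x≢a   | no x≢b   = λ e → free x x≢a x≢b (trans (cong y (sym (fixes x x≢a x≢b))) e)

  ∘t⇒off : ∀ {u} → IsFPFInv u → u b ≡ a → IsFPFInvOff a b (u ∘ t)
  ∘t⇒off {u} (inv , free) ub =
    commuting-involutions {f = u} inv transposition-involutive (swapping-commutes inv ub) ,
    trans (cong u sends-a) ub ,
    trans (cong u sends-b) (involution-swap inv ub) ,
    λ x x≢a x≢b e → free x (trans (cong u (sym (fixes x x≢a x≢b))) e)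

  module _ {w : Perm n} (w-inv : Involutive _≡_ w) where

    conjugate-sound : ∀ {y z} → IsFPFInvOff a b y → z ≗ w ∘ y ∘ t ∘ w → IsFPFInv z × z (w b) ≡ w a
    conjugate-sound {y} {z} y-off z≗ =
      IsFPFInv-resp {f = z} z≗ (IsFPFInv-conj {g = w} {h = w} {z = y ∘ t} w-inv w-inv yt-fpf) ,
      (begin
        z (w b)             ≡⟨ z≗ (w b) ⟩
        w (y (t (w (w b)))) ≡⟨ cong (w ∘ y ∘ t) (w-inv b) ⟩
        w (y (t b))         ≡⟨ cong w yt-b ⟩
        w a                 ∎)
      where
      open ≡-Reasoning
      yt-fpf : IsFPFInv (y ∘ t)
      yt-fpf = proj₁ (off⇒∘t y-off)
      yt-b : y (t b) ≡ a
      yt-b = proj₂ (off⇒∘t y-off)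

    conjugate-complete : ∀ {z} → IsFPFInv z → z (w b) ≡ w a →
                         Σ (Perm n) λ y → IsFPFInvOff a b y × z ≗ w ∘ y ∘ t ∘ w
    conjugate-complete {z} z-fpf z-wb = u ∘ t , ∘t⇒off {u = u} u-fpf u-b , z≗
      where
      open ≡-Reasoning
      u : Perm n
      u = w ∘ z ∘ w
      u-fpf : IsFPFInv u
      u-fpf = IsFPFInv-conj {g = w} {h = w} {z = z} w-inv w-inv z-fpf
      u-b : u b ≡ a
      u-b = trans (cong w z-wb) (w-inv a)
      z≗ : z ≗ w ∘ (u ∘ t) ∘ t ∘ w
      z≗ x = sym (begin
        w (u (t (t (w x))))   ≡⟨ cong (w ∘ u) (transposition-involutive (w x)) ⟩
        w (w (z (w (w x))))   ≡⟨ w-inv (z (w (w x))) ⟩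
        z (w (w x))           ≡⟨ cong z (w-inv x) ⟩
        z x                   ∎)

module _ {m : ℕ} where
  private
    N : ℕ
    N = suc (suc m)

  penult : Fin N
  penult = fromℕ< (s≤s (n≤1+n m))

  ult : Fin N
  ult = fromℕ (suc m)

  lab-penult : lab penult ≡ suc m
  lab-penult = cong suc (toℕ-fromℕ< (s≤s (n≤1+n m)))

  lab-ult : lab ult ≡ N
  lab-ult = cong suc (toℕ-fromℕ (suc m))

  lab-w₀-penult : lab (w₀ penult) ≡ 2
  lab-w₀-penult = trans (w₀-lab penult) (trans (cong (suc N ∸_) lab-penult) (m+n∸n≡m 2 m))

  lab-w₀-ult : lab (w₀ ult) ≡ 1
  lab-w₀-ult = trans (w₀-lab ult) (trans (cong (suc N ∸_) lab-ult) (m+n∸n≡m 1 N))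

  s-isTransposition : IsTransposition (s {N} (suc m)) penult ult
  s-isTransposition = record
    { distinct = λ e → 1+n≢n (trans (sym lab-ult) (trans (cong lab (sym e)) lab-penult))
    ; sends-a  = Sends⇒≡ (s-sends-left (s≤s z≤n) ≤-refl) lab-penult lab-ult
    ; sends-b  = Sends⇒≡ (s-sends-right (s≤s z≤n) ≤-refl) lab-ult lab-penult
    ; fixes    = λ x x≢a x≢b → lab-injective
        (s-sends-other (s≤s z≤n) ≤-refl (≢⇒lab≢ x≢a lab-penult) (≢⇒lab≢ x≢b lab-ult) x refl)
    }

  ≢penult∧≢ult⇒lab≤m : ∀ {x} → x ≢ penult → x ≢ ult → lab x ≤ m
  ≢penult∧≢ult⇒lab≤m {x} x≢a x≢b =
    m<1+n⇒m≤n (≤∧≢⇒< (m<1+n⇒m≤n (≤∧≢⇒< (toℕ<n x) (≢⇒lab≢ x≢b lab-ult))) (≢⇒lab≢ x≢a lab-penult))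

  lab≤m⇒≢penult : ∀ {x} → lab x ≤ m → x ≢ penult
  lab≤m⇒≢penult x≤m refl = 1+n≰n (subst (_≤ m) lab-penult x≤m)

  lab≤m⇒≢ult : ∀ {x} → lab x ≤ m → x ≢ ult
  lab≤m⇒≢ult x≤m refl = 1+n≰n (≤-trans (n≤1+n (suc m)) (subst (_≤ m) lab-ult x≤m))

  IsFPFInvSub⇒Off : ∀ {y} → IsFPFInvSub N y → IsFPFInvOff penult ult y
  IsFPFInvSub⇒Off (inv , fix-penult , fix-ult , free) =
    inv , fix-penult penult lab-penult , fix-ult ult lab-ult ,
    λ x x≢a x≢b → free x (≢penult∧≢ult⇒lab≤m x≢a x≢b)

  Off⇒IsFPFInvSub : ∀ {y} → IsFPFInvOff penult ult y → IsFPFInvSub N y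
  Off⇒IsFPFInvSub {y} (inv , y-penult , y-ult , free) =
    inv ,
    (λ x e → subst (λ w → y w ≡ w) (sym (lab-injective (trans e (sym lab-penult)))) y-penult) ,
    (λ x e → subst (λ w → y w ≡ w) (sym (lab-injective (trans e (sym lab-ult)))) y-ult) ,
    λ x x≤m → free x (lab≤m⇒≢penult x≤m) (lab≤m⇒≢ult x≤m)

  open Transposition s-isTransposition

  Y₁-sound : ∀ {z} → Y₁ N z → IsFPFInv z × Sends z 1 2
  Y₁-sound (y , y-sub , z≗) =
    map₂ (λ z-wb → ≡⇒Sends z-wb lab-w₀-ult lab-w₀-penult)
         (conjugate-sound {w = w₀} w₀-involutive {y = y} (IsFPFInvSub⇒Off y-sub) z≗)

  Y₁-complete : ∀ {z} → IsFPFInv z → Sends z 1 2 → Y₁ N z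
  Y₁-complete z-fpf z-12 =
    map₂ (map₁ Off⇒IsFPFInvSub)
         (conjugate-complete {w = w₀} w₀-involutive z-fpf (Sends⇒≡ z-12 lab-w₀-ult lab-w₀-penult))

  Y-sound : ∀ {i z} → 1 ≤ i → i < N → Y N i z → IsFPFInv z × Sends z 1 (suc i)
  Y-sound {i} {z} 1≤i i<N (y , y∈Y₁ , z≗) =
    IsFPFInv-resp {f = z} z≗ (IsFPFInv-conj {g = σ i} {h = σ⁻¹ i} {z = y} (σ-σ⁻¹ i i<N) (σ⁻¹-σ i i<N) y-fpf) ,
    Sends-resp {f = z} z≗
      (Sends-∘ {f = y ∘ σ⁻¹ i} {g = σ i} (σ-sends-1 i i<N)
        (Sends-∘ {f = σ⁻¹ i} {g = y} (Sends-swap {x = zero} (proj₁ y-fpf) y-12) (σ⁻¹-sends-1 i 1≤i i<N)))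
    where
    y-fpf : IsFPFInv y
    y-fpf = proj₁ (Y₁-sound y∈Y₁)
    y-12 : Sends y 1 2
    y-12 = proj₂ (Y₁-sound y∈Y₁)

  Y-complete : ∀ {i z} → 1 ≤ i → i < N → IsFPFInv z → Sends z 1 (suc i) → Y N i z
  Y-complete {i} {z} 1≤i i<N z-fpf z-1 = y , Y₁-complete y-fpf y-12 , z≗
    where
    y : Perm N
    y = σ⁻¹ i ∘ z ∘ σ i
    y-fpf : IsFPFInv y
    y-fpf = IsFPFInv-conj {g = σ⁻¹ i} {h = σ i} {z = z} (σ⁻¹-σ i i<N) (σ-σ⁻¹ i i<N) z-fpf
    y-12 : Sends y 1 2
    y-12 = Sends-∘ {f = z ∘ σ i} {g = σ⁻¹ i} (σ⁻¹-sends-1 i 1≤i i<N)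
             (Sends-∘ {f = σ i} {g = z} (Sends-swap {x = zero} (proj₁ z-fpf) z-1) (σ-sends-1 i i<N))
    z≗ : z ≗ σ i ∘ y ∘ σ⁻¹ i
    z≗ x = sym (trans (σ-σ⁻¹ i i<N (z (σ i (σ⁻¹ i x)))) (cong z (σ-σ⁻¹ i i<N x)))

  Y-disjoint : ∀ {i j z} → 1 ≤ i → i < N → 1 ≤ j → j < N → Y N i z → Y N j z → i ≡ j
  Y-disjoint 1≤i i<N 1≤j j<N z∈Yi z∈Yj = ℕ.suc-injective
    (trans (sym (proj₂ (Y-sound 1≤i i<N z∈Yi) zero refl)) (proj₂ (Y-sound 1≤j j<N z∈Yj) zero refl))

IsFPFInv⇒sends-1 : ∀ {n} {z : Perm (suc n)} → IsFPFInv z → Σ ℕ λ i → 1 ≤ i × i ≤ n × Sends z 1 (suc i)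
IsFPFInv⇒sends-1 {z = z} (_ , free) =
  toℕ (z zero) , ≤-trans (s≤s z≤n) (pred< (z zero) (free zero)) , toℕ≤pred[n] (z zero) ,
  ≡⇒Sends {f = z} refl refl refl

mainTheorem5 : (n : ℕ) → 4 ≤ n → 2 ∣ n →
    -- Y_i = { z ∈ 𝓕_n : z(1) = i+1 } for 1 ≤ i ≤ n-1
    ((i : ℕ) → 1 ≤ i → i ≤ n ∸ 1 → (z : Perm n) →
      (Y n i z → IsFPFInv z × ((x : Fin n) → lab x ≡ 1 → lab (z x) ≡ suc i)) ×
      (IsFPFInv z → ((x : Fin n) → lab x ≡ 1 → lab (z x) ≡ suc i) → Y n i z)) ×
    -- 𝓕_n = Y_1 ⊔ ⋯ ⊔ Y_{n-1}: every Y_i ⊆ 𝓕_n, they cover 𝓕_n, and are pairwise disjoint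
    ((i : ℕ) → 1 ≤ i → i ≤ n ∸ 1 → (z : Perm n) → Y n i z → IsFPFInv z) ×
    ((z : Perm n) → IsFPFInv z → Σ ℕ λ i → (1 ≤ i) × (i ≤ n ∸ 1) × Y n i z) ×
    ((i j : ℕ) → 1 ≤ i → i ≤ n ∸ 1 → 1 ≤ j → j ≤ n ∸ 1 → (z : Perm n) →
      Y n i z → Y n j z → i ≡ j)
mainTheorem5 1 (s≤s ()) _
mainTheorem5 (suc (suc m)) _ _ =
  (λ i 1≤i i≤ z → Y-sound 1≤i (s≤s i≤) , Y-complete 1≤i (s≤s i≤)) ,
  (λ i 1≤i i≤ z → proj₁ ∘ Y-sound 1≤i (s≤s i≤)) ,
  (λ z z-fpf → let i , 1≤i , i≤ , z-1 = IsFPFInv⇒sends-1 z-fpf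
               in i , 1≤i , i≤ , Y-complete 1≤i (s≤s i≤) z-fpf z-1) ,
  λ i j 1≤i i≤ 1≤j j≤ z → Y-disjoint 1≤i (s≤s i≤) 1≤j (s≤s j≤)
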